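{- Let $\phi_{\mathrm{xor}}$ be a satisfiable conjunction of xor-constraints and let $\langle \mathcal{E},\tau\rangle$ be a propagation saturated assigned tableau for $\phi_{\mathrm{xor}}$. Then the formula $\phi_{\mathrm{xor}} \land \bigwedge_{(x \mapsto v) \in \tau}(x \equiv v)$ is satisfiable if and only if $\langle \mathcal{E},\tau\rangle$ is consistent.
   Context: Truth values are $\mathbb{B}=\{\bot,\top\}$. An xor-constraint is an equation $x_1 \oplus \dots \oplus x_k \equiv p$ with Boolean variables $x_i$ and parity $p\in\mathbb{B}$ (duplicate variables cancel in pairs). A truth assignment $\tau$ (a possibly partial function from variables to $\mathbb{B}$) satisfies it if $\tau(x_1)\oplus\dots\oplus\tau(x_k)=p$. $\mathrm{vars}(\phi)$ denotes the set of variables of $\phi$. A tableau for a satisfiable conjunction $\phi_{\mathrm{xor}}$ of xor-constraints is a set $\mathcal{E}$ of equations of the form $x_i := x_{i,1}\oplus\dots\oplus x_{i,k_i}\oplus p_i$, where $x_i,x_{i,1},\dots,x_{i,k_i}$ are distinct variables of $\phi_{\mathrm{xor}}$ and $p_i\in\mathbb{B}$, such that: (1) each variable occurs at most once as a left-hand side variable; (2) a variable occurring as a left-hand side variable does not occur in any right-hand side; (3) $\bigwedge_{(x_i := x_{i,1}\oplus\dots\oplus x_{i,k_i}\oplus p_i)\in\mathcal{E}} (x_i\oplus x_{i,1}\oplus\dots\oplus x_{i,k_i}\equiv p_i)$ is logically equivalent to $\phi_{\mathrm{xor}}$. An assigned tableau for $\phi_{\mathrm{xor}}$ is a pair $\langle\mathcal{E},\tau\rangle$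 where $\mathcal{E}$ is a tableau for $\phi_{\mathrm{xor}}$ and $\tau$ is a possibly partial truth assignment on $\mathrm{vars}(\phi_{\mathrm{xor}})$. An equation $x_i := x_{i,1}\oplus\dots\oplus x_{i,k_i}\oplus p_i$ is propagation saturated w.r.t. $\tau$ if $\tau(x_i)$ is defined iff $\tau$ is defined on all of $x_{i,1},\dots,x_{i,k_i}$; the assigned tableau is propagation saturated if all its equations are. An equation is inconsistent if $\tau$ is defined on all of $x_i,x_{i,1},\dots,x_{i,k_i}$ and $\tau(x_i)\neq \tau(x_{i,1})\oplus\dots\oplus\tau(x_{i,k_i})\oplus p_i$; otherwise consistent. An assigned tableau is consistent iff none of its equations is inconsistent. -}

module Defs where

open import Data.Nat using (ℕ)
open import Data.Fin using (Fin)
open import Data.Bool using (Bool; _xor_; false)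
open import Data.Maybe using (Maybe; just; nothing; Is-just)
open import Data.List using (List; []; _∷_; foldr; map; concatMap)
open import Data.List.Membership.Propositional using (_∈_; _∉_)
open import Data.List.Relation.Unary.All using (All)
open import Data.List.Relation.Unary.Unique.Propositional using (Unique)
open import Data.Product using (Σ; ∃; _×_; _,_)
open import Relation.Binary.PropositionalEquality using (_≡_; _≢_)
open import Function.Bundles using (_⇔_)
open import Relation.Nullary using (¬_)

-- Variables are drawn from Fin n. A total assignment is Fin n → Bool,
-- a partial assignment is Fin n → Maybe Bool.

-- xor-constraint  x₁ ⊕ … ⊕ xₖ ≡ p  (duplicates allowed; they cancel by xor)
record XorConstraint (n : ℕ) : Set where
  constructor _≡ₓ_
  field
    xvars  : List (Fin n)
    parity : Bool
open XorConstraint public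

xorVals : {n : ℕ} → (Fin n → Bool) → List (Fin n) → Bool
xorVals σ = foldr (λ x b → σ x xor b) false

_⊨_ : {n : ℕ} → (Fin n → Bool) → XorConstraint n → Set
σ ⊨ c = xorVals σ (xvars c) ≡ parity c

XorFormula : ℕ → Set
XorFormula n = List (XorConstraint n)

_⊨ᶠ_ : {n : ℕ} → (Fin n → Bool) → XorFormula n → Set
σ ⊨ᶠ φ = All (σ ⊨_) φ

Satisfiable : {n : ℕ} → XorFormula n → Set
Satisfiable {n} φ = ∃ λ (σ : Fin n → Bool) → σ ⊨ᶠ φ

varsOf : {n : ℕ} → XorFormula n → List (Fin n)
varsOf φ = concatMap xvars φ

Extends : {n : ℕ} → (Fin n → Bool) → (Fin n → Maybe Bool) → Set
Extends σ τ = ∀ x v → τ x ≡ just v → σ x ≡ v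

SatisfiableUnder : {n : ℕ} → XorFormula n → (Fin n → Maybe Bool) → Set
SatisfiableUnder {n} φ τ = ∃ λ (σ : Fin n → Bool) → (σ ⊨ᶠ φ) × Extends σ τ

record Equation (n : ℕ) : Set where
  constructor _:=_⊕_
  field
    lhs : Fin n
    rhs : List (Fin n)
    par : Bool
open Equation public

eqConstraint : {n : ℕ} → Equation n → XorConstraint n
eqConstraint e = (lhs e ∷ rhs e) ≡ₓ par e

WellFormedEq : {n : ℕ} → XorFormula n → Equation n → Set
WellFormedEq φ e = Unique (lhs e ∷ rhs e) × All (_∈ varsOf φ) (lhs e ∷ rhs e)

record IsTableau {n : ℕ} (φ : XorFormula n) (E : List (Equation n)) : Set where
  field
    wellFormed   : All (WellFormedEq φ) E
    lhsUnique    : Unique (map lhs E)                                  -- (1)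
    lhsNotInRhs  : ∀ {e e′} → e ∈ E → e′ ∈ E → lhs e ∉ rhs e′           -- (2)
    equivalent   : ∀ (σ : Fin n → Bool) → (σ ⊨ᶠ φ) ⇔ (σ ⊨ᶠ map eqConstraint E)  -- (3)

OnVars : {n : ℕ} → XorFormula n → (Fin n → Maybe Bool) → Set
OnVars φ τ = ∀ x v → τ x ≡ just v → x ∈ varsOf φ

xorPartial : {n : ℕ} → (Fin n → Maybe Bool) → List (Fin n) → Maybe Bool
xorPartial τ [] = just false
xorPartial τ (x ∷ xs) with τ x | xorPartial τ xs
... | just a | just b = just (a xor b)
... | _      | _      = nothing

PropagationSaturatedEq : {n : ℕ} → (Fin n → Maybe Bool) → Equation n → Set
PropagationSaturatedEq τ e = Is-just (τ (lhs e)) ⇔ All (λ y → Is-just (τ y)) (rhs e)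

PropagationSaturated : {n : ℕ} → List (Equation n) → (Fin n → Maybe Bool) → Set
PropagationSaturated E τ = All (PropagationSaturatedEq τ) E

InconsistentEq : {n : ℕ} → (Fin n → Maybe Bool) → Equation n → Set
InconsistentEq τ e = ∃ λ a → ∃ λ b →
  (τ (lhs e) ≡ just a) × (xorPartial τ (rhs e) ≡ just b) × (a ≢ b xor par e)

Consistent : {n : ℕ} → List (Equation n) → (Fin n → Maybe Bool) → Set
Consistent E τ = All (λ e → ¬ InconsistentEq τ e) E

-- Condition (3) makes the tableau equations an equivalent presentation of φ, so
-- it suffices to satisfy the equations together with τ. A model extending τ
-- evaluates both sides of every equation consistently with τ, which gives
-- consistency. Conversely, by (2) the right-hand sides only mention non-basic
-- variables: keep τ on those (with an arbitrary default where τ is undefined)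
-- and compute every basic variable from its equation. By saturation a basic
-- variable is assigned by τ exactly when its whole right-hand side is, and then
-- consistency says that τ already agrees with the computed value.
module Submission where

open import Defs
open import Data.Nat using (ℕ)
open import Data.Fin using (Fin; _≟_)
open import Data.Bool using (Bool; false; _xor_)
open import Data.Bool.Properties using (xor-assoc; xor-comm; xor-same; xor-identityʳ)
  renaming (_≟_ to _≟ᵇ_)
open import Data.Maybe using (Maybe; just; nothing; Is-just; fromMaybe)
open import Data.Maybe.Relation.Unary.Any using (just)
open import Data.List using (List; []; _∷_; map)
open import Data.List.Relation.Unary.All using (All; []; _∷_; lookup; tabulate)
open import Data.List.Relation.Unary.All.Properties using (map⁺)
open import Data.List.Relation.Unary.Any using (here; there)
open import Data.List.Relation.Unary.AllPairs using (_∷_)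
open import Data.List.Membership.Propositional using (_∈_; _∉_)
open import Data.List.Membership.Propositional.Properties using (∈-map⁺)
open import Data.List.Relation.Unary.Unique.Propositional using (Unique)
open import Data.Product using (∃; _×_; _,_)
open import Data.Empty using (⊥-elim)
open import Relation.Nullary using (yes; no)
open import Relation.Nullary.Decidable using (decidable-stable)
open import Relation.Binary.PropositionalEquality
open import Function.Bundles using (_⇔_; mk⇔; Equivalence)

xor-cancelʳ : ∀ a b → (a xor b) xor b ≡ a
xor-cancelʳ a b = begin
  (a xor b) xor b  ≡⟨ xor-assoc a b b ⟩
  a xor (b xor b)  ≡⟨ cong (a xor_) (xor-same b) ⟩
  a xor false      ≡⟨ xor-identityʳ a ⟩
  a                ∎
  where open ≡-Reasoning

xor-≡⇔≡-xor : ∀ a b p → a xor b ≡ p ⇔ a ≡ b xor p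
xor-≡⇔≡-xor a b p = mk⇔
  (λ ab≡p → trans (sym (xor-cancelʳ a b)) (trans (cong (_xor b) ab≡p) (xor-comm p b)))
  (λ a≡bp → trans (cong (λ c → c xor b) (trans a≡bp (xor-comm b p))) (xor-cancelʳ p b))

module _ {n : ℕ} where

  Assignment PartialAssignment : Set
  Assignment        = Fin n → Bool
  PartialAssignment = Fin n → Maybe Bool

  ⊨eqConstraint⇔ : (σ : Assignment) (e : Equation n) →
                   σ ⊨ eqConstraint e ⇔ σ (lhs e) ≡ xorVals σ (rhs e) xor par e
  ⊨eqConstraint⇔ σ e = xor-≡⇔≡-xor (σ (lhs e)) (xorVals σ (rhs e)) (par e)

  xorVals-cong : ∀ {σ σ′ : Assignment} xs → All (λ y → σ y ≡ σ′ y) xs →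
                 xorVals σ xs ≡ xorVals σ′ xs
  xorVals-cong []       []         = refl
  xorVals-cong (x ∷ xs) (eq ∷ eqs) = cong₂ _xor_ eq (xorVals-cong xs eqs)

  xorPartial-sound : ∀ {σ : Assignment} {τ : PartialAssignment} xs {v} → Extends σ τ → xorPartial τ xs ≡ just v →
                     xorVals σ xs ≡ v
  xorPartial-sound []       ext refl = refl
  xorPartial-sound {τ = τ} (x ∷ xs) ext eq with τ x in τx | xorPartial τ xs in τxs
  ... | just a | just b with refl ← eq =
    cong₂ _xor_ (ext x a τx) (xorPartial-sound xs ext τxs)

  xorPartial-defined : ∀ {τ : PartialAssignment} xs → All (λ y → Is-just (τ y)) xs →
                       ∃ λ v → xorPartial τ xs ≡ just v
  xorPartial-defined []       [] = false , refl
  xorPartial-defined {τ} (x ∷ xs) (τx-def ∷ τxs-def)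
    with τ x | τx-def | xorPartial τ xs | xorPartial-defined xs τxs-def
  ... | just a | _ | .(just b) | b , refl = a xor b , refl

  completion : PartialAssignment → Assignment
  completion τ x = fromMaybe false (τ x)

  completion-extends : ∀ τ → Extends (completion τ) τ
  completion-extends τ x v τx rewrite τx = refl

  equationFor : List (Equation n) → Fin n → Maybe (Equation n)
  equationFor []      x = nothing
  equationFor (e ∷ E) x with lhs e ≟ x
  ... | yes _ = just e
  ... | no  _ = equationFor E x

  equationFor-sound : ∀ E {x e} → equationFor E x ≡ just e → e ∈ E × lhs e ≡ x
  equationFor-sound (e′ ∷ E) {x} eq with lhs e′ ≟ x
  equationFor-sound (e′ ∷ E) refl | yes e′≡x = here refl , e′≡x
  ... | no _ = let e∈E , e≡x = equationFor-sound E eq in there e∈E , e≡x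

  equationFor-complete : ∀ {E e} → Unique (map lhs E) → e ∈ E → equationFor E (lhs e) ≡ just e
  equationFor-complete {e′ ∷ E} _ (here refl) with lhs e′ ≟ lhs e′
  ... | yes _   = refl
  ... | no  ≢e′ = ⊥-elim (≢e′ refl)
  equationFor-complete {e′ ∷ E} {e} (lhs-fresh ∷ unique) (there e∈E) with lhs e′ ≟ lhs e
  ... | yes e′≡e = ⊥-elim (lookup lhs-fresh (∈-map⁺ lhs e∈E) e′≡e)
  ... | no  _    = equationFor-complete unique e∈E

  extension⇒consistent : ∀ {E τ} {σ : Assignment} → σ ⊨ᶠ map eqConstraint E → Extends σ τ → Consistent E τ
  extension⇒consistent {E} {σ = σ} σ⊨E ext = tabulate λ {e} e∈E (a , b , τlhs , τrhs , a≢) →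
    let σ⊨e = lookup σ⊨E (∈-map⁺ eqConstraint e∈E)
    in  a≢ (begin
          a                            ≡⟨ sym (ext (lhs e) a τlhs) ⟩
          σ (lhs e)                    ≡⟨ Equivalence.to (⊨eqConstraint⇔ σ e) σ⊨e ⟩
          xorVals σ (rhs e) xor par e  ≡⟨ cong (_xor par e) (xorPartial-sound (rhs e) ext τrhs) ⟩
          b xor par e                  ∎)
    where open ≡-Reasoning

  module BasicSolution (E : List (Equation n)) (τ : PartialAssignment) where

    valueBy : Maybe (Equation n) → Fin n → Bool
    valueBy (just e) x = xorVals (completion τ) (rhs e) xor par e
    valueBy nothing  x = completion τ x

    basicSolution : Assignment
    basicSolution x = valueBy (equationFor E x) x

    basicSolution-rhs : (∀ {e e′} → e ∈ E → e′ ∈ E → lhs e ∉ rhs e′) →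
                        ∀ {e′} → e′ ∈ E → All (λ y → basicSolution y ≡ completion τ y) (rhs e′)
    basicSolution-rhs lhs∉rhs {e′} e′∈E = tabulate nonbasic
      where
      nonbasic : ∀ {y} → y ∈ rhs e′ → basicSolution y ≡ completion τ y
      nonbasic {y} y∈rhs with equationFor E y in eq
      ... | nothing = refl
      ... | just e with equationFor-sound E eq
      ... | e∈E , refl = ⊥-elim (lhs∉rhs e∈E e′∈E y∈rhs)

    basicSolution-⊨ : Unique (map lhs E) → (∀ {e e′} → e ∈ E → e′ ∈ E → lhs e ∉ rhs e′) →
                      basicSolution ⊨ᶠ map eqConstraint E
    basicSolution-⊨ unique lhs∉rhs = map⁺ (tabulate λ {e} e∈E →
      Equivalence.from (⊨eqConstraint⇔ basicSolution e) (begin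
        basicSolution (lhs e)                          ≡⟨ cong (λ m → valueBy m (lhs e))
                                                               (equationFor-complete unique e∈E) ⟩
        xorVals (completion τ) (rhs e) xor par e       ≡⟨ cong (_xor par e)
                                                               (xorVals-cong (rhs e) (basicSolution-rhs lhs∉rhs e∈E)) ⟨
        xorVals basicSolution (rhs e) xor par e        ∎))
      where open ≡-Reasoning

    basicSolution-extends : PropagationSaturated E τ → Consistent E τ → Extends basicSolution τ
    basicSolution-extends saturated consistent x v τx with equationFor E x in eq
    ... | nothing = completion-extends τ x v τx
    ... | just e with equationFor-sound E eq
    ... | e∈E , refl =
      let rhs-defined = Equivalence.to (lookup saturated e∈E) (subst Is-just (sym τx) (just _))
          b , τrhs    = xorPartial-defined (rhs e) rhs-defined
          v≡b-xor-p   = decidable-stable (v ≟ᵇ b xor par e)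
                          (λ v≢ → lookup consistent e∈E (v , b , τx , τrhs , v≢))
      in  trans (cong (_xor par e) (xorPartial-sound (rhs e) (completion-extends τ) τrhs))
                (sym v≡b-xor-p)

lemma1 : {n : ℕ} (φ : XorFormula n) (E : List (Equation n)) (τ : Fin n → Maybe Bool) →
         Satisfiable φ → IsTableau φ E → OnVars φ τ → PropagationSaturated E τ →
         SatisfiableUnder φ τ ⇔ Consistent E τ
lemma1 φ E τ _ tableau _ saturated = mk⇔
  (λ (σ , σ⊨φ , ext) → extension⇒consistent (Equivalence.to (equivalent σ) σ⊨φ) ext)
  (λ consistent → basicSolution
                , Equivalence.from (equivalent basicSolution) (basicSolution-⊨ lhsUnique lhsNotInRhs)
                , basicSolution-extends saturated consistent)
  where
  open IsTableau tableau
  open BasicSolution E τ
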